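{- For all integers $j\geq 1$, let $d_{j}$ be the number of letters $0$ between the $j$-th letter $1$ and the $(j+1)$-th letter $1$ in the Cantor sequence $\mathbf{c}$, and for $i,j\geq1$ let $f(i,j)=j+\sum_{\ell=i}^{i+j-1}d_{\ell}$. Then for every $j\geq 1$, \[d_{2j-1}=1\quad\text{and}\quad d_{2j}=3d_{j}.\] Moreover, for all $i,j\geq 1$, \[f(2i,2j)=3f(i,j),\quad f(2i,2j+1)=3f(i,j+1)-2,\quad f(2i+1,2j)=3f(i+1,j),\quad f(2i+1,2j+1)=3f(i+1,j)+2.\]
   Context: The Cantor sequence $\mathbf{c}=c_0c_1c_2\cdots\in\{0,1\}^{\mathbb N}$ is defined by $c_0=1$ and $c_{3n}=c_{3n+2}=c_n$, $c_{3n+1}=0$ for all $n\geq 0$; equivalently, it is the fixed point beginning with $1$ of the morphism $\sigma:0\mapsto000,\ 1\mapsto101$. The occurrences of the letter $1$ in $\mathbf c$ are counted starting from the first one ($c_0$ is the $1$st letter $1$). -}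

module Defs where

open import Data.Bool using (Bool; true; false; not)
open import Data.Nat using (ℕ; zero; suc; _+_; _*_; _∸_; _^_; _≡ᵇ_)
open import Data.Nat.DivMod using (_/_; _%_)
open import Data.List using (List; []; _∷_; filter; upTo; map; length; head)
open import Data.Nat.ListAction using (sum)
open import Data.Maybe using (Maybe; just; nothing)
open import Relation.Nullary.Decidable using (does)
open import Relation.Binary.PropositionalEquality using (_≡_)
open import Data.Bool.Properties using (_≟_)

-- Cantor sequence, computed with fuel (fuel n suffices since n / 3 < n for n ≥ 1):
--   c 0 = 1, c (3n) = c (3n+2) = c n, c (3n+1) = 0.   (true = letter 1, false = letter 0)
cantorAux : ℕ → ℕ → Bool
cantorAux zero    _       = true
cantorAux (suc k) zero    = true
cantorAux (suc k) (suc m) with (suc m) % 3 ≡ᵇ 1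
... | true  = false
... | false = cantorAux k (suc m / 3)

cantor : ℕ → Bool
cantor n = cantorAux n n

range : ℕ → ℕ → List ℕ
range a b = map (a +_) (upTo (b ∸ a))

onesBelow : ℕ → List ℕ
onesBelow N = filter (λ n → cantor n ≟ true) (upTo N)

dropL : ℕ → List ℕ → List ℕ
dropL zero    xs       = xs
dropL (suc k) []       = []
dropL (suc k) (x ∷ xs) = dropL k xs

-- position of the j-th letter 1 (j ≥ 1; c_0 is the 1st).  The j-th 1 lies below 3^j
-- (there are 2^j ≥ j ones in [0, 3^j)), so searching in [0, 3^j) is exhaustive.
-- Default value 0 is never used for j ≥ 1.
onePos : ℕ → ℕ
onePos j with head (dropL (j ∸ 1) (onesBelow (3 ^ j)))
... | just p  = p
... | nothing = 0

d : ℕ → ℕ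
d j = length (filter (λ n → cantor n ≟ false) (range (suc (onePos j)) (onePos (suc j))))

f : ℕ → ℕ → ℕ
f i j = j + sum (map (λ k → d (i + k)) (upTo j))

module Submission where

-- Write pos j for the position of the (j+1)-th letter 1 of c (so pos j
-- = onePos (suc j)).  Since c_{3n} = c_{3n+2} = c_n and c_{3n+1} = 0, the ones in
-- [0, 3N) come in pairs 3n, 3n+2 over the ones n < N; hence the number of ones
-- below 3N is twice the number below N, and
--     pos (2m) = 3 pos m,        pos (2m+1) = 3 pos m + 2.
-- Everything else is arithmetic on pos:  d (j+1) = pos (j+1) - pos j - 1  (the
-- letters strictly between two consecutive ones are zeros), and by telescoping
--     f (a+1) j = pos (a+j) - pos a.
-- The file first unfolds the recursion of the Cantor sequence, then studies the
-- counting function ones N = #{n < N | c_n = 1}, uses it to characterise onePos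
-- (a letter 1 with exactly j ones before it is found by the bounded search), derives
-- the two recursions for pos, expresses d and f through pos, and finally obtains
-- each identity of the theorem by substituting those recursions.

open import Defs
open import Data.Bool using (Bool; true; false; if_then_else_)
import Data.Bool.Properties as Boolₚ
open import Data.Nat
open import Data.Nat.Properties
open import Data.Nat.DivMod
open import Data.Nat.Divisibility using (m∣m*n)
open import Data.Nat.ListAction using (sum)
open import Data.Nat.Tactic.RingSolver using (solve-∀)
open import Data.List using (List; []; _∷_; _++_; [_]; length; filter; upTo; applyUpTo; map; head)
open import Data.List.Properties
  using (upTo-∷ʳ; length-++; filter-++; filter-all; ++-identityʳ; ++-assoc;
         length-map; length-upTo; map-upTo; map-applyUpTo; map-cong)
open import Data.List.Relation.Unary.All using (All)
open import Data.List.Relation.Unary.All.Properties using (map⁺; applyUpTo⁺₁)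
open import Data.Maybe using (just)
open import Data.Product using (_×_; _,_; ∃-syntax)
open import Data.Sum using (inj₁; inj₂)
open import Function using (_∘_)
open import Relation.Nullary using (yes; no; contradiction)
open import Relation.Binary.PropositionalEquality
  using (_≡_; refl; sym; trans; cong; cong₂; subst; subst₂; module ≡-Reasoning)

cantorAux-fuel : ∀ {k k′ m} → m ≤ k → m ≤ k′ → cantorAux k m ≡ cantorAux k′ m
cantorAux-fuel {zero}  {zero}   {zero}  _ _ = refl
cantorAux-fuel {zero}  {suc _}  {zero}  _ _ = refl
cantorAux-fuel {suc _} {zero}   {zero}  _ _ = refl
cantorAux-fuel {suc _} {suc _}  {zero}  _ _ = refl
cantorAux-fuel {suc k} {suc k′} {suc m} (s≤s m≤k) (s≤s m≤k′) with suc m % 3 ≡ᵇ 1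
... | true  = refl
... | false = cantorAux-fuel (≤-trans quot≤m m≤k) (≤-trans quot≤m m≤k′)
  where quot≤m : suc m / 3 ≤ m
        quot≤m = <⇒≤pred (m/n<m (suc m) 3 (s≤s (s≤s z≤n)))

cantor-middle : ∀ m → (suc m % 3 ≡ᵇ 1) ≡ true → cantor (suc m) ≡ false
cantor-middle m digit≡1 with suc m % 3 ≡ᵇ 1
cantor-middle m refl | true = refl

cantor-outer : ∀ m → (suc m % 3 ≡ᵇ 1) ≡ false → cantor (suc m) ≡ cantor (suc m / 3)
cantor-outer m digit≢1 with suc m % 3 ≡ᵇ 1
cantor-outer m refl | false =
  cantorAux-fuel (<⇒≤pred (m/n<m (suc m) 3 (s≤s (s≤s z≤n)))) ≤-refl

digit-mod : ∀ r n → (r + 3 * n) % 3 ≡ r % 3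
digit-mod r n = trans (cong (λ x → (r + x) % 3) (*-comm 3 n)) ([m+kn]%n≡m%n r n 3)

digit-div : ∀ r n → r < 3 → (r + 3 * n) / 3 ≡ n
digit-div r n r<3 = begin
  (r + 3 * n) / 3     ≡⟨ +-distrib-/-∣ʳ r (m∣m*n n) ⟩
  r / 3 + 3 * n / 3   ≡⟨ cong₂ _+_ (m<n⇒m/n≡0 r<3) (trans (cong (_/ 3) (*-comm 3 n)) (m*n/n≡m n 3)) ⟩
  n                   ∎
  where open ≡-Reasoning

cantor-3n : ∀ n → cantor (3 * n) ≡ cantor n
cantor-3n zero    = refl
cantor-3n (suc n) = trans (cantor-outer (n + 2 * suc n) (cong (_≡ᵇ 1) (digit-mod 0 (suc n))))
                          (cong cantor (digit-div 0 (suc n) (s≤s z≤n)))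

cantor-3n+1 : ∀ n → cantor (1 + 3 * n) ≡ false
cantor-3n+1 n = cantor-middle (3 * n) (cong (_≡ᵇ 1) (digit-mod 1 n))

cantor-3n+2 : ∀ n → cantor (2 + 3 * n) ≡ cantor n
cantor-3n+2 n = trans (cantor-outer (1 + 3 * n) (cong (_≡ᵇ 1) (digit-mod 2 n)))
                      (cong cantor (digit-div 2 n (s≤s (s≤s (s≤s z≤n)))))

bit : Bool → ℕ
bit true  = 1
bit false = 0

onesBelow-suc : ∀ N → onesBelow (suc N) ≡ onesBelow N ++ (if cantor N then [ N ] else [])
onesBelow-suc N = begin
  filter P (upTo (suc N))               ≡⟨ cong (filter P) (sym (upTo-∷ʳ N)) ⟩
  filter P (upTo N ++ [ N ])            ≡⟨ filter-++ P (upTo N) [ N ] ⟩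
  filter P (upTo N) ++ filter P [ N ]   ≡⟨ cong (filter P (upTo N) ++_) last ⟩
  filter P (upTo N) ++ (if cantor N then [ N ] else [])   ∎
  where
  open ≡-Reasoning
  P = λ n → cantor n Boolₚ.≟ true
  last : filter P [ N ] ≡ (if cantor N then [ N ] else [])
  last with cantor N
  ... | true  = refl
  ... | false = refl

ones : ℕ → ℕ
ones N = length (onesBelow N)

ones-suc : ∀ N → ones (suc N) ≡ bit (cantor N) + ones N
ones-suc N = begin
  ones (suc N)                                          ≡⟨ cong length (onesBelow-suc N) ⟩
  length (onesBelow N ++ (if cantor N then [ N ] else [])) ≡⟨ length-++ (onesBelow N) ⟩
  ones N + length (if cantor N then [ N ] else [])      ≡⟨ +-comm (ones N) _ ⟩
  length (if cantor N then [ N ] else []) + ones N      ≡⟨ cong (_+ ones N) (letter-count (cantor N)) ⟩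
  bit (cantor N) + ones N                               ∎
  where
  open ≡-Reasoning
  letter-count : ∀ b → length (if b then [ N ] else []) ≡ bit b
  letter-count true  = refl
  letter-count false = refl

onesBelow-prefix : ∀ {m n} → m ≤ n → ∃[ R ] onesBelow n ≡ onesBelow m ++ R
onesBelow-prefix {m} {zero} z≤n = [] , sym (++-identityʳ _)
onesBelow-prefix {m} {suc n} m≤1+n with m≤n⇒m<n∨m≡n m≤1+n
... | inj₂ refl = [] , sym (++-identityʳ _)
... | inj₁ m<1+n with onesBelow-prefix (s≤s⁻¹ m<1+n)
...   | R , eq = R ++ _ , trans (onesBelow-suc n) (trans (cong (_++ (if cantor n then [ n ] else [])) eq) (++-assoc (onesBelow m) R _))

ones-mono : ∀ {m n} → m ≤ n → ones m ≤ ones n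
ones-mono {m} {n} m≤n with onesBelow-prefix m≤n
... | R , eq = subst (ones m ≤_) (sym (trans (cong length eq) (length-++ (onesBelow m)))) (m≤m+n (ones m) _)

ones-reflects-< : ∀ {m n} → ones m < ones n → m < n
ones-reflects-< lt = ≰⇒> (λ n≤m → <⇒≱ lt (ones-mono n≤m))

-- Each 1 at position n < N gives the ones 3n and 3n+2 in [0, 3N), and nothing else does.
ones-triple : ∀ n → ones (3 * n) ≡ 2 * ones n
ones-triple zero    = refl
ones-triple (suc n) = begin
  ones (3 * suc n)                                         ≡⟨ cong ones (*-suc 3 n) ⟩
  ones (3 + 3 * n)                                         ≡⟨ ones-suc (2 + 3 * n) ⟩
  bit (cantor (2 + 3 * n)) + ones (2 + 3 * n)              ≡⟨ cong₂ _+_ (cong bit (cantor-3n+2 n)) (ones-suc (1 + 3 * n)) ⟩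
  b + (bit (cantor (1 + 3 * n)) + ones (1 + 3 * n))        ≡⟨ cong (λ x → b + (bit x + ones (1 + 3 * n))) (cantor-3n+1 n) ⟩
  b + ones (1 + 3 * n)                                     ≡⟨ cong (b +_) (ones-suc (3 * n)) ⟩
  b + (bit (cantor (3 * n)) + ones (3 * n))                ≡⟨ cong₂ (λ x y → b + (bit x + y)) (cantor-3n n) (ones-triple n) ⟩
  b + (b + 2 * ones n)                                     ≡⟨ doubling b (ones n) ⟩
  2 * (b + ones n)                                         ≡⟨ cong (2 *_) (sym (ones-suc n)) ⟩
  2 * ones (suc n)                                         ∎
  where
  open ≡-Reasoning
  b = bit (cantor n)
  doubling : ∀ x y → x + (x + 2 * y) ≡ 2 * (x + y)
  doubling = solve-∀

ones-pow3 : ∀ k → ones (3 ^ k) ≡ 2 ^ k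
ones-pow3 zero    = refl
ones-pow3 (suc k) = trans (ones-triple (3 ^ k)) (cong (2 *_) (ones-pow3 k))

n<2^n : ∀ n → n < 2 ^ n
n<2^n zero    = s≤s z≤n
n<2^n (suc n) = begin-strict
  suc n          ≤⟨ n<2^n n ⟩
  2 ^ n          <⟨ m<m+n (2 ^ n) (m^n>0 2 n) ⟩
  2 ^ n + 2 ^ n  ≡⟨ cong (2 ^ n +_) (sym (+-identityʳ (2 ^ n))) ⟩
  2 ^ suc n      ∎
  where open ≤-Reasoning

-- The (j+1)-th letter 1 exists inside the search window [0, 3^(j+1)) used by onePos.
rank-window : ∀ j → j < ones (3 ^ suc j)
rank-window j = subst (j <_) (sym (ones-pow3 (suc j))) (<-trans (n<1+n j) (n<2^n (suc j)))

-- p carries the (j+1)-th letter 1 of c: c_p = 1 and exactly j ones precede it.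
record OneOfRank (j p : ℕ) : Set where
  constructor oneOfRank
  field
    letter : cantor p ≡ true
    rank   : ones p ≡ j

rank-bound : ∀ {j p} → OneOfRank j p → p < 3 ^ suc j
rank-bound {j} (oneOfRank _ rank) = ones-reflects-< (subst (_< ones (3 ^ suc j)) (sym rank) (rank-window j))

dropL-++ : ∀ (xs ys : List ℕ) → dropL (length xs) (xs ++ ys) ≡ ys
dropL-++ []       ys = refl
dropL-++ (x ∷ xs) ys = dropL-++ xs ys

onePos-head : ∀ j p → head (dropL j (onesBelow (3 ^ suc j))) ≡ just p → onePos (suc j) ≡ p
onePos-head j p found with head (dropL j (onesBelow (3 ^ suc j)))
onePos-head j p refl | just .p = refl

onePos-unique : ∀ {j p} → OneOfRank j p → onePos (suc j) ≡ p
onePos-unique {j} {p} one@(oneOfRank isOne rank) with onesBelow-prefix (rank-bound one)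
... | R , eq = onePos-head j p (begin
  head (dropL j (onesBelow (3 ^ suc j)))                  ≡⟨ cong (head ∘ dropL j) eq ⟩
  head (dropL j (onesBelow (suc p) ++ R))                 ≡⟨ cong (λ xs → head (dropL j (xs ++ R))) (onesBelow-suc p) ⟩
  head (dropL j ((onesBelow p ++ (if cantor p then [ p ] else [])) ++ R))
       ≡⟨ cong (λ b → head (dropL j ((onesBelow p ++ (if b then [ p ] else [])) ++ R))) isOne ⟩
  head (dropL j ((onesBelow p ++ [ p ]) ++ R))            ≡⟨ cong (λ xs → head (dropL j xs)) (++-assoc (onesBelow p) [ p ] R) ⟩
  head (dropL j (onesBelow p ++ p ∷ R))                   ≡⟨ cong (λ i → head (dropL i (onesBelow p ++ p ∷ R))) (sym rank) ⟩
  head (dropL (ones p) (onesBelow p ++ p ∷ R))            ≡⟨ cong head (dropL-++ (onesBelow p) (p ∷ R)) ⟩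
  just p                                                  ∎)
  where open ≡-Reasoning

-- Discrete intermediate value theorem: ones increases by at most one per step, so
-- every rank below ones N is attained by a letter 1 in [0, N).
ones-ivt : ∀ N j → j < ones N → ∃[ p ] OneOfRank j p
ones-ivt (suc N) j j<ones = step (subst (j <_) (ones-suc N) j<ones)
  where
  step : j < bit (cantor N) + ones N → ∃[ p ] OneOfRank j p
  step j<ones′ with j <? ones N | cantor N in isOne
  ... | yes j<onesN | _     = ones-ivt N j j<onesN
  ... | no  j≮onesN | true  = N , oneOfRank isOne (≤-antisym (≮⇒≥ j≮onesN) (s≤s⁻¹ j<ones′))
  ... | no  j≮onesN | false = contradiction j<ones′ j≮onesN

pos : ℕ → ℕ
pos j = onePos (suc j)

pos-rank : ∀ j → OneOfRank j (pos j)
pos-rank j with ones-ivt (3 ^ suc j) j (rank-window j)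
... | p , one = subst (OneOfRank j) (sym (onePos-unique one)) one

rank-even : ∀ {m p} → OneOfRank m p → OneOfRank (2 * m) (3 * p)
rank-even {m} {p} (oneOfRank isOne rank) = oneOfRank (trans (cantor-3n p) isOne) (trans (ones-triple p) (cong (2 *_) rank))

rank-odd : ∀ {m p} → OneOfRank m p → OneOfRank (suc (2 * m)) (2 + 3 * p)
rank-odd {m} {p} (oneOfRank isOne rank) = oneOfRank (trans (cantor-3n+2 p) isOne) (begin
  ones (2 + 3 * p)                                     ≡⟨ ones-suc (1 + 3 * p) ⟩
  bit (cantor (1 + 3 * p)) + ones (1 + 3 * p)          ≡⟨ cong₂ (λ b n → bit b + n) (cantor-3n+1 p) (ones-suc (3 * p)) ⟩
  bit (cantor (3 * p)) + ones (3 * p)                  ≡⟨ cong₂ (λ b n → bit b + n) (trans (cantor-3n p) isOne) (ones-triple p) ⟩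
  suc (2 * ones p)                                     ≡⟨ cong (suc ∘ (2 *_)) rank ⟩
  suc (2 * m)                                          ∎)
  where open ≡-Reasoning

pos-even : ∀ m → pos (2 * m) ≡ 3 * pos m
pos-even m = onePos-unique (rank-even (pos-rank m))

pos-odd : ∀ m → pos (suc (2 * m)) ≡ 2 + 3 * pos m
pos-odd m = onePos-unique (rank-odd (pos-rank m))

ones-flat : ∀ {a b k} → ones a ≡ ones b → a ≤ k → k < b → cantor k ≡ false
ones-flat {a} {b} {k} flat a≤k k<b with cantor k in isOne
... | false = refl
... | true  = contradiction (begin
  suc (ones k)     ≡⟨ cong (_+ ones k) (cong bit (sym isOne)) ⟩
  bit (cantor k) + ones k ≡⟨ sym (ones-suc k) ⟩
  ones (suc k)     ≤⟨ ones-mono k<b ⟩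
  ones b           ≡⟨ sym flat ⟩
  ones a           ≤⟨ ones-mono a≤k ⟩
  ones k           ∎) (1+n≰n {ones k})
  where open ≤-Reasoning

zeros-in : ∀ {a b} → ones a ≡ ones b → a ≤ b →
           length (filter (λ n → cantor n Boolₚ.≟ false) (range a b)) ≡ b ∸ a
zeros-in {a} {b} flat a≤b = begin
  length (filter (λ n → cantor n Boolₚ.≟ false) (range a b))  ≡⟨ cong length (filter-all (λ n → cantor n Boolₚ.≟ false) all-zero) ⟩
  length (range a b)                                           ≡⟨ length-map (a +_) (upTo (b ∸ a)) ⟩
  length (upTo (b ∸ a))                                        ≡⟨ length-upTo (b ∸ a) ⟩
  b ∸ a                                                        ∎
  where
  open ≡-Reasoning
  inside : ∀ {k} → k < b ∸ a → a + k < b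
  inside {k} k<b∸a = subst (a + k <_) (m+[n∸m]≡n a≤b) (+-monoʳ-< a k<b∸a)
  all-zero : All (λ n → cantor n ≡ false) (range a b)
  all-zero = map⁺ (applyUpTo⁺₁ (λ k → k) (b ∸ a) (λ k<b∸a → ones-flat flat (m≤m+n a _) (inside k<b∸a)))

pos-< : ∀ j → pos j < pos (suc j)
pos-< j = ones-reflects-< (subst₂ _<_ (sym (OneOfRank.rank (pos-rank j))) (sym (OneOfRank.rank (pos-rank (suc j)))) (n<1+n j))

d-gap : ∀ j → d (suc j) ≡ pos (suc j) ∸ suc (pos j)
d-gap j = zeros-in (trans after-pos-j (sym (OneOfRank.rank (pos-rank (suc j))))) (pos-< j)
  where
  after-pos-j : ones (suc (pos j)) ≡ suc j
  after-pos-j = trans (ones-suc (pos j)) (cong₂ (λ b n → bit b + n) (OneOfRank.letter (pos-rank j)) (OneOfRank.rank (pos-rank j)))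

d-gap⁺ : ∀ j → d (suc j) + suc (pos j) ≡ pos (suc j)
d-gap⁺ j = trans (cong (_+ suc (pos j)) (d-gap j)) (m∸n+n≡m (pos-< j))

gapSum : ℕ → ℕ → ℕ
gapSum i j = sum (map (λ k → d (i + k)) (upTo j))

gapSum-suc : ∀ i j → gapSum i (suc j) ≡ d i + gapSum (suc i) j
gapSum-suc i j = cong₂ (λ x xs → d x + sum xs) (+-identityʳ i) (begin
  map (λ k → d (i + k)) (applyUpTo suc j)      ≡⟨ map-applyUpTo suc (λ k → d (i + k)) j ⟩
  applyUpTo (λ k → d (i + suc k)) j            ≡⟨ sym (map-upTo (λ k → d (i + suc k)) j) ⟩
  map (λ k → d (i + suc k)) (upTo j)           ≡⟨ map-cong (λ k → cong d (+-suc i k)) (upTo j) ⟩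
  map (λ k → d (suc i + k)) (upTo j)           ∎)
  where open ≡-Reasoning

f-suc : ∀ i j → f i (suc j) ≡ suc (d i + f (suc i) j)
f-suc i j = trans (cong (suc j +_) (gapSum-suc i j)) (cong suc (rearrange j (d i) (gapSum (suc i) j)))
  where
  rearrange : ∀ x y z → x + (y + z) ≡ y + (x + z)
  rearrange = solve-∀

pos-telescope : ∀ a j → f (suc a) j + pos a ≡ pos (a + j)
pos-telescope a zero    = cong pos (sym (+-identityʳ a))
pos-telescope a (suc j) = begin
  f (suc a) (suc j) + pos a                           ≡⟨ cong (_+ pos a) (f-suc (suc a) j) ⟩
  suc (d (suc a) + f (suc (suc a)) j) + pos a         ≡⟨ rearrange (d (suc a)) (f (suc (suc a)) j) (pos a) ⟩
  f (suc (suc a)) j + (d (suc a) + suc (pos a))       ≡⟨ cong (f (suc (suc a)) j +_) (d-gap⁺ a) ⟩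
  f (suc (suc a)) j + pos (suc a)                     ≡⟨ pos-telescope (suc a) j ⟩
  pos (suc a + j)                                     ≡⟨ cong pos (sym (+-suc a j)) ⟩
  pos (a + suc j)                                     ∎
  where
  open ≡-Reasoning
  rearrange : ∀ x y z → suc (x + y) + z ≡ y + (x + suc z)
  rearrange = solve-∀

f-pos : ∀ a j → f (suc a) j ≡ pos (a + j) ∸ pos a
f-pos a j = trans (sym (m+n∸n≡m (f (suc a) j) (pos a))) (cong (_∸ pos a) (pos-telescope a j))

pos-mono : ∀ a j → pos a ≤ pos (a + j)
pos-mono a j = subst (pos a ≤_) (pos-telescope a j) (m≤n+m (pos a) (f (suc a) j))

d-odd : ∀ m → d (suc (2 * m)) ≡ 1
d-odd m = begin
  d (suc (2 * m))                             ≡⟨ d-gap (2 * m) ⟩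
  pos (suc (2 * m)) ∸ suc (pos (2 * m))       ≡⟨ cong₂ (λ x y → x ∸ suc y) (pos-odd m) (pos-even m) ⟩
  (2 + 3 * pos m) ∸ suc (3 * pos m)           ≡⟨ m+n∸n≡m 1 (3 * pos m) ⟩
  1                                           ∎
  where open ≡-Reasoning

d-even : ∀ m → d (2 * suc m) ≡ 3 * d (suc m)
d-even m = begin
  d (2 * suc m)                                   ≡⟨ cong d (*-suc 2 m) ⟩
  d (suc (suc (2 * m)))                           ≡⟨ d-gap (suc (2 * m)) ⟩
  pos (2 + 2 * m) ∸ suc (pos (suc (2 * m)))       ≡⟨ cong₂ (λ x y → x ∸ suc y) (cong pos (sym (*-suc 2 m))) (pos-odd m) ⟩
  pos (2 * suc m) ∸ (3 + 3 * pos m)               ≡⟨ cong₂ _∸_ (pos-even (suc m)) (sym (*-suc 3 (pos m))) ⟩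
  3 * pos (suc m) ∸ 3 * suc (pos m)               ≡⟨ sym (*-distribˡ-∸ 3 (pos (suc m)) (suc (pos m))) ⟩
  3 * (pos (suc m) ∸ suc (pos m))                 ≡⟨ cong (3 *_) (sym (d-gap m)) ⟩
  3 * d (suc m)                                   ∎
  where open ≡-Reasoning

f-even-even : ∀ a j → f (2 * suc a) (2 * j) ≡ 3 * f (suc a) j
f-even-even a j = begin
  f (2 * suc a) (2 * j)                              ≡⟨ cong (λ i → f i (2 * j)) (*-suc 2 a) ⟩
  f (suc (suc (2 * a))) (2 * j)                      ≡⟨ f-pos (suc (2 * a)) (2 * j) ⟩
  pos (suc (2 * a + 2 * j)) ∸ pos (suc (2 * a))      ≡⟨ cong (λ n → pos (suc n) ∸ pos (suc (2 * a))) (sym (*-distribˡ-+ 2 a j)) ⟩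
  pos (suc (2 * (a + j))) ∸ pos (suc (2 * a))        ≡⟨ cong₂ _∸_ (pos-odd (a + j)) (pos-odd a) ⟩
  (2 + 3 * pos (a + j)) ∸ (2 + 3 * pos a)            ≡⟨ sym (*-distribˡ-∸ 3 (pos (a + j)) (pos a)) ⟩
  3 * (pos (a + j) ∸ pos a)                          ≡⟨ cong (3 *_) (sym (f-pos a j)) ⟩
  3 * f (suc a) j                                    ∎
  where open ≡-Reasoning

f-even-odd : ∀ a j → f (2 * suc a) (2 * j + 1) ≡ 3 * f (suc a) (j + 1) ∸ 2
f-even-odd a j = begin
  f (2 * suc a) (2 * j + 1)                          ≡⟨ cong (λ i → f i (2 * j + 1)) (*-suc 2 a) ⟩
  f (suc (suc (2 * a))) (2 * j + 1)                  ≡⟨ f-pos (suc (2 * a)) (2 * j + 1) ⟩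
  pos (suc (2 * a) + (2 * j + 1)) ∸ pos (suc (2 * a)) ≡⟨ cong (λ n → pos n ∸ pos (suc (2 * a))) (index a j) ⟩
  pos (2 * (a + (j + 1))) ∸ pos (suc (2 * a))        ≡⟨ cong₂ _∸_ (pos-even (a + (j + 1))) (trans (pos-odd a) (+-comm 2 (3 * pos a))) ⟩
  3 * P ∸ (3 * pos a + 2)                            ≡⟨ sym (∸-+-assoc (3 * P) (3 * pos a) 2) ⟩
  3 * P ∸ 3 * pos a ∸ 2                              ≡⟨ cong (_∸ 2) (sym (*-distribˡ-∸ 3 P (pos a))) ⟩
  3 * (P ∸ pos a) ∸ 2                                ≡⟨ cong (λ x → 3 * x ∸ 2) (sym (f-pos a (j + 1))) ⟩
  3 * f (suc a) (j + 1) ∸ 2                          ∎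
  where
  open ≡-Reasoning
  P = pos (a + (j + 1))
  index : ∀ x y → suc (2 * x) + (2 * y + 1) ≡ 2 * (x + (y + 1))
  index = solve-∀

f-odd-even : ∀ a j → f (2 * suc a + 1) (2 * j) ≡ 3 * f (suc a + 1) j
f-odd-even a j = begin
  f (2 * suc a + 1) (2 * j)                          ≡⟨ cong (λ i → f i (2 * j)) (+-comm (2 * suc a) 1) ⟩
  f (suc (2 * suc a)) (2 * j)                        ≡⟨ f-pos (2 * suc a) (2 * j) ⟩
  pos (2 * suc a + 2 * j) ∸ pos (2 * suc a)          ≡⟨ cong (λ n → pos n ∸ pos (2 * suc a)) (sym (*-distribˡ-+ 2 (suc a) j)) ⟩
  pos (2 * (suc a + j)) ∸ pos (2 * suc a)            ≡⟨ cong₂ _∸_ (pos-even (suc a + j)) (pos-even (suc a)) ⟩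
  3 * pos (suc a + j) ∸ 3 * pos (suc a)              ≡⟨ sym (*-distribˡ-∸ 3 (pos (suc a + j)) (pos (suc a))) ⟩
  3 * (pos (suc a + j) ∸ pos (suc a))                ≡⟨ cong (3 *_) (sym (f-pos (suc a) j)) ⟩
  3 * f (suc (suc a)) j                              ≡⟨ cong (λ i → 3 * f i j) (+-comm 1 (suc a)) ⟩
  3 * f (suc a + 1) j                                ∎
  where open ≡-Reasoning

f-odd-odd : ∀ a j → f (2 * suc a + 1) (2 * j + 1) ≡ 3 * f (suc a + 1) j + 2
f-odd-odd a j = begin
  f (2 * suc a + 1) (2 * j + 1)                      ≡⟨ cong (λ i → f i (2 * j + 1)) (+-comm (2 * suc a) 1) ⟩
  f (suc (2 * suc a)) (2 * j + 1)                    ≡⟨ f-pos (2 * suc a) (2 * j + 1) ⟩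
  pos (2 * suc a + (2 * j + 1)) ∸ pos (2 * suc a)    ≡⟨ cong (λ n → pos n ∸ pos (2 * suc a)) (index (suc a) j) ⟩
  pos (suc (2 * (suc a + j))) ∸ pos (2 * suc a)      ≡⟨ cong₂ _∸_ (pos-odd (suc a + j)) (pos-even (suc a)) ⟩
  (2 + 3 * P) ∸ 3 * pos (suc a)                      ≡⟨ +-∸-assoc 2 (*-monoʳ-≤ 3 (pos-mono (suc a) j)) ⟩
  2 + (3 * P ∸ 3 * pos (suc a))                      ≡⟨ +-comm 2 _ ⟩
  (3 * P ∸ 3 * pos (suc a)) + 2                      ≡⟨ cong (_+ 2) (sym (*-distribˡ-∸ 3 P (pos (suc a)))) ⟩
  3 * (P ∸ pos (suc a)) + 2                          ≡⟨ cong (λ x → 3 * x + 2) (sym (f-pos (suc a) j)) ⟩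
  3 * f (suc (suc a)) j + 2                          ≡⟨ cong (λ i → 3 * f i j + 2) (+-comm 1 (suc a)) ⟩
  3 * f (suc a + 1) j + 2                            ∎
  where
  open ≡-Reasoning
  P = pos (suc a + j)
  index : ∀ x y → 2 * x + (2 * y + 1) ≡ suc (2 * (x + y))
  index = solve-∀

lemma4p1 : ((j : ℕ) → 1 ≤ j → (d (2 * j ∸ 1) ≡ 1) × (d (2 * j) ≡ 3 * d j))
    × ((i j : ℕ) → 1 ≤ i → 1 ≤ j →
         (f (2 * i) (2 * j) ≡ 3 * f i j)
       × (f (2 * i) (2 * j + 1) ≡ 3 * f i (j + 1) ∸ 2)
       × (f (2 * i + 1) (2 * j) ≡ 3 * f (i + 1) j)
       × (f (2 * i + 1) (2 * j + 1) ≡ 3 * f (i + 1) j + 2))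
lemma4p1 = gaps , blocks
  where
  gaps : (j : ℕ) → 1 ≤ j → (d (2 * j ∸ 1) ≡ 1) × (d (2 * j) ≡ 3 * d j)
  gaps (suc m) _ = trans (cong (λ n → d (n ∸ 1)) (*-suc 2 m)) (d-odd m) , d-even m
  blocks : (i j : ℕ) → 1 ≤ i → 1 ≤ j →
             (f (2 * i) (2 * j) ≡ 3 * f i j)
           × (f (2 * i) (2 * j + 1) ≡ 3 * f i (j + 1) ∸ 2)
           × (f (2 * i + 1) (2 * j) ≡ 3 * f (i + 1) j)
           × (f (2 * i + 1) (2 * j + 1) ≡ 3 * f (i + 1) j + 2)
  blocks (suc a) j _ _ = f-even-even a j , f-even-odd a j , f-odd-even a j , f-odd-odd a j
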